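{- Let $r\geq 4$, let $Z_r$ be the rank-$r$ binary spike on $E=\{x_1,\dots,x_r,y_1,\dots,y_r,t\}$ with tip $t$, and let $X\subseteq E$ with $t\in X$. Suppose there is a set $C\subseteq E$ with $|C|=r$, $|C\cap\{x_i,y_i\}|=1$ for all $1\le i\le r$, and $|C\cap\{y_1,\dots,y_r\}|$ odd, such that $|C\cap X|$ is even. Then the $es$-splitting matroid $(Z_r)^t_X$ is not isomorphic to the spike $Z_{r+1}$.
   Context: $Z_r$ ($r\ge3$) is the vector matroid over $GF(2)$ of the $r\times(2r+1)$ matrix $[I_r\,|\,J_r-I_r\,|\,\mathbf 1]$ ($J_r$ the all-ones $r\times r$ matrix, $\mathbf 1$ the all-ones column), with columns labeled in order $x_1,\dots,x_r,y_1,\dots,y_r,t$; it is a spike with tip $t$ and legs $\{t,x_i,y_i\}$. The sets $C$ described in the claim are circuits of $Z_r$. $es$-splitting: for a binary matroid $M$ on $E$ represented over $GF(2)$ by a matrix $A$, a set $X\subseteq E$ and $e\in X$, let $A^e_X$ be obtained from $A$ by adjoining a new last row that is $1$ in the columns of elements of $X$ and $0$ elsewhere, and then adjoining two new columns $\alpha$ (zero except $1$ in the new last row) and $\gamma$ (the sum of the columns of $\alpha$ and $e$). $M^e_X$ is the vector matroid of $A^e_X$, on $E\cup\{\alpha,\gamma\}$. -}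

module Defs where

open import Data.Nat using (ℕ; zero; suc; _+_)
open import Data.Bool using (Bool; true; false; _xor_; _∧_; not)
open import Data.Fin using (Fin; zero; suc; _↑ˡ_; _↑ʳ_; splitAt)
open import Data.Fin.Subset using (Subset; _⊆_; Nonempty; ⁅_⁆; _∪_)
open import Data.Vec using (lookup; tabulate)
open import Data.Sum using (inj₁; inj₂)
open import Data.Product using (Σ; _×_)
open import Relation.Nullary using (¬_; does)
open import Relation.Binary.PropositionalEquality using (_≡_)
open import Function.Definitions using (Bijective)
open import Function.Bundles using (_⇔_)
import Data.Fin as F

-- GF(2) is Bool with xor (addition) and ∧ (multiplication).
-- A binary m × n matrix: entry in row i, column j is A i j.
Mat : ℕ → ℕ → Set
Mat m n = Fin m → Fin n → Bool

xorSum : ∀ {n} → (Fin n → Bool) → Bool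
xorSum {zero} f = false
xorSum {suc n} f = f zero xor xorSum (λ j → f (suc j))

colSum : ∀ {m n} → Mat m n → Subset n → Fin m → Bool
colSum A T i = xorSum (λ j → lookup T j ∧ A i j)

Indep : ∀ {m n} → Mat m n → Subset n → Set
Indep A S = ∀ (T : Subset _) → T ⊆ S → Nonempty T → ¬ (∀ i → colSum A T i ≡ false)

-- isomorphism of vector matroids M[A] ≅ M[B]: a bijection f between the
-- ground sets with  I independent in M[B]  iff  f⁻¹(I) independent in M[A]
Iso : ∀ {m n m' n'} → Mat m n → Mat m' n' → Set
Iso {n = n} {n' = n'} A B =
  Σ (Fin n → Fin n') λ f → Bijective _≡_ _≡_ f ×
    (∀ (I : Subset n') → Indep A (tabulate (λ j → lookup I (f j))) ⇔ Indep B I)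

-- Ground set of Z_r : Fin (r + r + 1), ordered x_1..x_r, y_1..y_r, t
xe : ∀ r → Fin r → Fin (r + r + 1)
xe r i = (i ↑ˡ r) ↑ˡ 1

ye : ∀ r → Fin r → Fin (r + r + 1)
ye r i = (r ↑ʳ i) ↑ˡ 1

tip : ∀ r → Fin (r + r + 1)
tip r = (r + r) ↑ʳ zero

-- the matrix [I_r | J_r - I_r | 1]
Zmat : ∀ r → Mat r (r + r + 1)
Zmat r i j with splitAt (r + r) j
... | inj₂ _ = true
... | inj₁ k with splitAt r k
...   | inj₁ a = does (a F.≟ i)
...   | inj₂ b = not (does (b F.≟ i))

Yset : ∀ r → Subset (r + r + 1)
Yset r = tabulate (λ j → Yb j)
  where
  Yb : Fin (r + r + 1) → Bool
  Yb j with splitAt (r + r) j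
  ... | inj₂ _ = false
  ... | inj₁ k with splitAt r k
  ...   | inj₁ _ = false
  ...   | inj₂ _ = true

pairXY : ∀ r → Fin r → Subset (r + r + 1)
pairXY r i = ⁅ xe r i ⁆ ∪ ⁅ ye r i ⁆

-- es-splitting A^e_X : new last row = indicator of X, then columns α, γ = α + e
-- Rows: Fin (m + 1) (last row = the new one); columns: Fin (n + 2)
-- (original columns, then α, then γ).
extCol : ∀ {m n} → Mat m n → Subset n → Fin n → Fin (m + 1) → Bool
extCol {m} A X j i with splitAt m i
... | inj₁ i' = A i' j
... | inj₂ _ = lookup X j

alphaCol : ∀ {m} → Fin (m + 1) → Bool
alphaCol {m} i with splitAt m i
... | inj₁ _ = false
... | inj₂ _ = true

split : ∀ {m n} → Mat m n → Subset n → Fin n → Mat (m + 1) (n + 2)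
split {m} {n} A X e i j with splitAt n j
... | inj₁ j' = extCol A X j' i
... | inj₂ zero = alphaCol i
... | inj₂ (suc _) = alphaCol i xor extCol A X e i

-- Lift C to the ground set of A = (Z_r)^t_X. Since C meets every leg of Z_r once, avoids t
-- and contains an odd number of y's, its columns sum to zero in Z_r, and since |C ∩ X| is
-- even they also sum to zero in the new row: C is a cycle of A. An isomorphism onto Z_{r+1}
-- would carry C to a dependent set D of size r, so some nonempty T ⊆ D has zero column sum.
-- In Z_{r+1} such a T either meets each of the r+1 legs in exactly one element, impossible
-- as |T| ≤ r, or contains a whole leg {x_k, y_k}. Then the triangle {t, x_k, y_k} pulls back
-- to a dependent set {u, v, w} of A with u, v ∈ C on distinct legs of Z_r. But the top part
-- of every column of A has the form c·𝟏 + e_m, and for r ≥ 4 a vanishing combination of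
-- three such columns, two of them on distinct legs, can only involve the column α, whose
-- entry in the new row is 1. So {u, v, w} is independent, a contradiction.

module Submission where

open import Defs
open import Algebra.Bundles using (CommutativeRing)
open import Data.Bool using (Bool; true; false; _xor_; _∧_; _∨_; not)
open import Data.Bool.Properties
  using (∧-zeroʳ; ∧-identityʳ; ∧-distribˡ-xor; xor-assoc; xor-identityʳ; xor-same; ¬-not; xor-∧-commutativeRing)
open import Data.Fin as Fin using (Fin; zero; suc; _↑ˡ_; _↑ʳ_; splitAt)
open import Data.Fin.Properties
  using (↑ˡ-injective; ↑ʳ-injective; splitAt-↑ˡ; splitAt-↑ʳ; splitAt⁻¹-↑ˡ; splitAt⁻¹-↑ʳ; pigeonhole; <-irrefl)
open import Data.Fin.Subset using (Subset; inside; outside; ⊥; ∣_∣; ⁅_⁆; _∪_; _∩_; _∈_; Nonempty)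
open import Data.Fin.Subset.Properties using (∣⊥∣≡0; p⊆q⇒∣p∣≤∣q∣)
open import Data.Fin.Permutation using (Permutation; _⟨$⟩ʳ_; _⟨$⟩ˡ_; inverseˡ; inverseʳ; flip)
open import Data.Nat using (ℕ; zero; suc; _+_; _%_; _<_; _≤_)
open import Data.Nat.DivMod using (%-distribˡ-+)
open import Data.Nat.Properties using (+-assoc; +-identityʳ; +-0-commutativeMonoid)
import Data.Nat.Properties as ℕ
open import Data.Product using (∃; _×_; _,_; proj₁; proj₂)
open import Data.Sum using (_⊎_; inj₁; inj₂)
open import Data.Maybe using (Maybe; just; nothing; fromMaybe)
open import Data.Vec using ([]; _∷_; _++_; lookup; tabulate)
open import Data.Vec.Properties
  using (lookup∘tabulate; lookup-replicate; lookup-zipWith; lookup-++ˡ; lookup-++ʳ; lookup⇒[]=; []=⇒lookup)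
open import Function using (_∘_; _∋_; case_of_)
open import Function.Bundles using (_⇔_; Equivalence; mk⤖)
open import Function.Properties.Bijection using (⤖⇒↔)
open import Relation.Binary.PropositionalEquality
open import Relation.Nullary using (¬_; does; yes; no; contradiction)
open import Relation.Nullary.Decidable using (dec-true; dec-false)
open import Data.Bool.Solver using (module xor-∧-Solver)
open xor-∧-Solver using (solve; _:+_; _:*_; _:=_)
open import Algebra.Properties.CommutativeSemigroup
  (CommutativeRing.+-commutativeSemigroup xor-∧-commutativeRing) using (interchange)
open import Algebra.Properties.CommutativeMonoid.Sum +-0-commutativeMonoid
  using (sum; sum-permute; sum-cong-≗; ∑-distrib-+)

private variable
  m n : ℕ

xor≡false⇒≡ : ∀ a b → a xor b ≡ false → a ≡ b
xor≡false⇒≡ false false _ = refl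
xor≡false⇒≡ true  true  _ = refl

∧-cancelˡ : ∀ t {x y} → x ≢ y → t ∧ x ≡ t ∧ y → t ≡ false
∧-cancelˡ false _   _ = refl
∧-cancelˡ true  x≢y eq = contradiction eq x≢y

bit : Bool → ℕ
bit false = 0
bit true  = 1

bit-injective : ∀ {a b} → bit a ≡ bit b → a ≡ b
bit-injective {false} {false} _ = refl
bit-injective {true}  {true}  _ = refl

xorSum-cong : {f g : Fin n → Bool} → (∀ j → f j ≡ g j) → xorSum f ≡ xorSum g
xorSum-cong {zero} f≗g = refl
xorSum-cong {suc n} f≗g = cong₂ _xor_ (f≗g zero) (xorSum-cong (f≗g ∘ suc))

xorSum-false : xorSum {n} (λ _ → false) ≡ false
xorSum-false {zero} = refl
xorSum-false {suc n} = xorSum-false {n}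

xorSum-xor : (f g : Fin n → Bool) → xorSum (λ j → f j xor g j) ≡ xorSum f xor xorSum g
xorSum-xor {zero} f g = refl
xorSum-xor {suc n} f g = begin
  (f zero xor g zero) xor xorSum (λ j → f (suc j) xor g (suc j))
    ≡⟨ cong ((f zero xor g zero) xor_) (xorSum-xor (f ∘ suc) (g ∘ suc)) ⟩
  (f zero xor g zero) xor (xorSum (f ∘ suc) xor xorSum (g ∘ suc))
    ≡⟨ interchange (f zero) (g zero) _ _ ⟩
  (f zero xor xorSum (f ∘ suc)) xor (g zero xor xorSum (g ∘ suc)) ∎
  where open ≡-Reasoning

xorSum-↑ : ∀ m n (h : Fin (m + n) → Bool) →
  xorSum h ≡ xorSum (h ∘ (_↑ˡ n)) xor xorSum (h ∘ (m ↑ʳ_))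
xorSum-↑ zero    n h = refl
xorSum-↑ (suc m) n h =
  trans (cong (h zero xor_) (xorSum-↑ m n (h ∘ suc))) (sym (xor-assoc (h zero) _ _))

xorSum-δ : (g : Fin n → Bool) (i : Fin n) → xorSum (λ a → g a ∧ does (a Fin.≟ i)) ≡ g i
xorSum-δ {suc n} g zero = begin
  (g zero ∧ true) xor xorSum (λ a → g (suc a) ∧ false)
    ≡⟨ cong₂ _xor_ (∧-identityʳ (g zero)) (xorSum-cong (∧-zeroʳ ∘ g ∘ suc)) ⟩
  g zero xor xorSum {n} (λ _ → false)
    ≡⟨ cong (g zero xor_) (xorSum-false {n}) ⟩
  g zero xor false
    ≡⟨ xor-identityʳ (g zero) ⟩
  g zero ∎
  where open ≡-Reasoning
xorSum-δ {suc n} g (suc i) =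
  trans (cong (_xor xorSum (λ a → g (suc a) ∧ does (a Fin.≟ i))) (∧-zeroʳ (g zero)))
        (xorSum-δ (g ∘ suc) i)

xorSum≡true⇒∃ : (f : Fin n → Bool) → xorSum f ≡ true → ∃ λ j → f j ≡ true
xorSum≡true⇒∃ {suc n} f sum≡true with f zero in f₀
... | true  = zero , f₀
... | false with j , fj ← xorSum≡true⇒∃ (f ∘ suc) sum≡true = suc j , fj

xorSum-support₃ : {u v w : Fin n} → u ≢ v → u ≢ w → v ≢ w → (T h : Fin n → Bool) →
  (∀ j → T j ≡ true → j ≡ u ⊎ j ≡ v ⊎ j ≡ w) →
  xorSum (λ j → T j ∧ h j) ≡ (T u ∧ h u) xor ((T v ∧ h v) xor (T w ∧ h w))
xorSum-support₃ {u = u} {v} {w} u≢v u≢w v≢w T h support = begin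
  xorSum (λ j → T j ∧ h j)
    ≡⟨ xorSum-cong pointwise ⟩
  xorSum (λ j → (tu ∧ δ u j) xor ((tv ∧ δ v j) xor (tw ∧ δ w j)))
    ≡⟨ xorSum-xor (λ j → tu ∧ δ u j) (λ j → (tv ∧ δ v j) xor (tw ∧ δ w j)) ⟩
  xorSum (λ j → tu ∧ δ u j) xor xorSum (λ j → (tv ∧ δ v j) xor (tw ∧ δ w j))
    ≡⟨ cong (xorSum (λ j → tu ∧ δ u j) xor_) (xorSum-xor (λ j → tv ∧ δ v j) (λ j → tw ∧ δ w j)) ⟩
  xorSum (λ j → tu ∧ δ u j) xor (xorSum (λ j → tv ∧ δ v j) xor xorSum (λ j → tw ∧ δ w j))
    ≡⟨ cong₂ _xor_ (xorSum-δ (λ _ → tu) u)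
                   (cong₂ _xor_ (xorSum-δ (λ _ → tv) v) (xorSum-δ (λ _ → tw) w)) ⟩
  tu xor (tv xor tw) ∎
  where
  open ≡-Reasoning
  tu = T u ∧ h u
  tv = T v ∧ h v
  tw = T w ∧ h w
  δ : Fin _ → Fin _ → Bool
  δ p j = does (j Fin.≟ p)
  pointwise : ∀ j → T j ∧ h j ≡ (tu ∧ δ u j) xor ((tv ∧ δ v j) xor (tw ∧ δ w j))
  pointwise j with j Fin.≟ u | j Fin.≟ v | j Fin.≟ w
  ... | yes refl | yes refl | _        = contradiction refl u≢v
  ... | yes refl | _        | yes refl = contradiction refl u≢w
  ... | _        | yes refl | yes refl = contradiction refl v≢w
  ... | yes refl | no _     | no _
    rewrite ∧-identityʳ tu | ∧-zeroʳ tv | ∧-zeroʳ tw = sym (xor-identityʳ tu)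
  ... | no _     | yes refl | no _
    rewrite ∧-identityʳ tv | ∧-zeroʳ tu | ∧-zeroʳ tw = sym (xor-identityʳ tv)
  ... | no _     | no _     | yes refl
    rewrite ∧-identityʳ tw | ∧-zeroʳ tu | ∧-zeroʳ tv = refl
  ... | no j≢u   | no j≢v   | no j≢w
    rewrite ∧-zeroʳ tu | ∧-zeroʳ tv | ∧-zeroʳ tw with T j in Tj
  ...   | false = refl
  ...   | true with support j Tj
  ...     | inj₁ j≡u        = contradiction j≡u j≢u
  ...     | inj₂ (inj₁ j≡v) = contradiction j≡v j≢v
  ...     | inj₂ (inj₂ j≡w) = contradiction j≡w j≢w

∣p∣%2≡xorSum : (p : Subset n) → ∣ p ∣ % 2 ≡ bit (xorSum (lookup p))
∣p∣%2≡xorSum []            = refl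
∣p∣%2≡xorSum (outside ∷ p) = ∣p∣%2≡xorSum p
∣p∣%2≡xorSum (inside  ∷ p) = begin
  (1 + ∣ p ∣) % 2                  ≡⟨ %-distribˡ-+ 1 ∣ p ∣ 2 ⟩
  (1 + ∣ p ∣ % 2) % 2              ≡⟨ cong (λ k → (1 + k) % 2) (∣p∣%2≡xorSum p) ⟩
  (1 + bit (xorSum (lookup p))) % 2 ≡⟨ flip-bit (xorSum (lookup p)) ⟩
  bit (not (xorSum (lookup p)))    ∎
  where
  open ≡-Reasoning
  flip-bit : ∀ b → (1 + bit b) % 2 ≡ bit (not b)
  flip-bit false = refl
  flip-bit true  = refl

xorSum-parity : (p : Subset n) (b : Bool) → ∣ p ∣ % 2 ≡ bit b → xorSum (lookup p) ≡ b
xorSum-parity p b ∣p∣%2≡b = bit-injective (trans (sym (∣p∣%2≡xorSum p)) ∣p∣%2≡b)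

lookup-⁅⁆ : (x j : Fin n) → lookup ⁅ x ⁆ j ≡ does (j Fin.≟ x)
lookup-⁅⁆ zero    zero    = refl
lookup-⁅⁆ zero    (suc j) = lookup-replicate j outside
lookup-⁅⁆ (suc x) zero    = refl
lookup-⁅⁆ (suc x) (suc j) = lookup-⁅⁆ x j

lookup-∩ : (p q : Subset n) (j : Fin n) → lookup (p ∩ q) j ≡ lookup p j ∧ lookup q j
lookup-∩ p q j = lookup-zipWith _∧_ j p q

xorSum-∩-pair : {x y : Fin n} → x ≢ y → (p : Subset n) →
  xorSum (lookup (p ∩ (⁅ x ⁆ ∪ ⁅ y ⁆))) ≡ lookup p x xor lookup p y
xorSum-∩-pair {x = x} {y} x≢y p = begin
  xorSum (lookup (p ∩ (⁅ x ⁆ ∪ ⁅ y ⁆)))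
    ≡⟨ xorSum-cong pointwise ⟩
  xorSum (λ j → (lookup p j ∧ does (j Fin.≟ x)) xor (lookup p j ∧ does (j Fin.≟ y)))
    ≡⟨ xorSum-xor (λ j → lookup p j ∧ does (j Fin.≟ x)) (λ j → lookup p j ∧ does (j Fin.≟ y)) ⟩
  xorSum (λ j → lookup p j ∧ does (j Fin.≟ x)) xor xorSum (λ j → lookup p j ∧ does (j Fin.≟ y))
    ≡⟨ cong₂ _xor_ (xorSum-δ (lookup p) x) (xorSum-δ (lookup p) y) ⟩
  lookup p x xor lookup p y ∎
  where
  open ≡-Reasoning
  disjoint : ∀ j → does (j Fin.≟ x) ∨ does (j Fin.≟ y) ≡ does (j Fin.≟ x) xor does (j Fin.≟ y)
  disjoint j with j Fin.≟ x | j Fin.≟ y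
  ... | yes refl | yes refl = contradiction refl x≢y
  ... | yes _    | no _     = refl
  ... | no _     | _        = refl
  pointwise : ∀ j → lookup (p ∩ (⁅ x ⁆ ∪ ⁅ y ⁆)) j
                  ≡ (lookup p j ∧ does (j Fin.≟ x)) xor (lookup p j ∧ does (j Fin.≟ y))
  pointwise j = begin
    lookup (p ∩ (⁅ x ⁆ ∪ ⁅ y ⁆)) j
      ≡⟨ lookup-∩ p _ j ⟩
    lookup p j ∧ lookup (⁅ x ⁆ ∪ ⁅ y ⁆) j
      ≡⟨ cong (lookup p j ∧_) (lookup-zipWith _∨_ j ⁅ x ⁆ ⁅ y ⁆) ⟩
    lookup p j ∧ (lookup ⁅ x ⁆ j ∨ lookup ⁅ y ⁆ j)
      ≡⟨ cong (lookup p j ∧_) (cong₂ _∨_ (lookup-⁅⁆ x j) (lookup-⁅⁆ y j)) ⟩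
    lookup p j ∧ (does (j Fin.≟ x) ∨ does (j Fin.≟ y))
      ≡⟨ cong (lookup p j ∧_) (disjoint j) ⟩
    lookup p j ∧ (does (j Fin.≟ x) xor does (j Fin.≟ y))
      ≡⟨ ∧-distribˡ-xor (lookup p j) _ _ ⟩
    (lookup p j ∧ does (j Fin.≟ x)) xor (lookup p j ∧ does (j Fin.≟ y)) ∎

∣p∣≡∑ : (p : Subset n) → ∣ p ∣ ≡ sum (bit ∘ lookup p)
∣p∣≡∑ []            = refl
∣p∣≡∑ (outside ∷ p) = ∣p∣≡∑ p
∣p∣≡∑ (inside  ∷ p) = cong suc (∣p∣≡∑ p)

∑-↑ : ∀ m n (h : Fin (m + n) → ℕ) → sum h ≡ sum (h ∘ (_↑ˡ n)) + sum (h ∘ (m ↑ʳ_))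
∑-↑ zero    n h = refl
∑-↑ (suc m) n h = trans (cong (h zero +_) (∑-↑ m n (h ∘ suc))) (sym (+-assoc (h zero) _ _))

∣∣-permute : (π : Permutation m n) (p : Subset n) → ∣ tabulate (lookup p ∘ (π ⟨$⟩ʳ_)) ∣ ≡ ∣ p ∣
∣∣-permute π p = begin
  ∣ tabulate (lookup p ∘ (π ⟨$⟩ʳ_)) ∣
    ≡⟨ ∣p∣≡∑ (tabulate (lookup p ∘ (π ⟨$⟩ʳ_))) ⟩
  sum (bit ∘ lookup (tabulate (lookup p ∘ (π ⟨$⟩ʳ_))))
    ≡⟨ sum-cong-≗ (cong bit ∘ lookup∘tabulate (lookup p ∘ (π ⟨$⟩ʳ_))) ⟩
  sum (bit ∘ lookup p ∘ (π ⟨$⟩ʳ_))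
    ≡⟨ sum-permute (bit ∘ lookup p) π ⟨
  sum (bit ∘ lookup p)
    ≡⟨ ∣p∣≡∑ p ⟨
  ∣ p ∣ ∎
  where open ≡-Reasoning

∣p++⊥∣≡∣p∣ : ∀ n (p : Subset m) → ∣ p ++ ⊥ {n} ∣ ≡ ∣ p ∣
∣p++⊥∣≡∣p∣ n []            = ∣⊥∣≡0 n
∣p++⊥∣≡∣p∣ n (outside ∷ p) = ∣p++⊥∣≡∣p∣ n p
∣p++⊥∣≡∣p∣ n (inside  ∷ p) = cong suc (∣p++⊥∣≡∣p∣ n p)

-- The spike Z_R

Cycle : Mat m n → Subset n → Set
Cycle A T = ∀ i → colSum A T i ≡ false

↑ˡ≢↑ʳ : (i : Fin m) (j : Fin n) → i ↑ˡ n ≢ m ↑ʳ j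
↑ˡ≢↑ʳ {m} {n} i j eq =
  case trans (sym (splitAt-↑ˡ m i n)) (trans (cong (splitAt m) eq) (splitAt-↑ʳ m n j)) of λ ()

module _ (R : ℕ) where

  xe-injective : ∀ {i j} → xe R i ≡ xe R j → i ≡ j
  xe-injective = ↑ˡ-injective R _ _ ∘ ↑ˡ-injective 1 _ _

  ye-injective : ∀ {i j} → ye R i ≡ ye R j → i ≡ j
  ye-injective = ↑ʳ-injective R _ _ ∘ ↑ˡ-injective 1 _ _

  xe≢ye : ∀ i j → xe R i ≢ ye R j
  xe≢ye i j = ↑ˡ≢↑ʳ i j ∘ ↑ˡ-injective 1 _ _

  xe≢tip : ∀ i → xe R i ≢ tip R
  xe≢tip i = ↑ˡ≢↑ʳ (i ↑ˡ R) zero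

  ye≢tip : ∀ i → ye R i ≢ tip R
  ye≢tip i = ↑ˡ≢↑ʳ (R ↑ʳ i) zero

  data GroundView : Fin (R + R + 1) → Set where
    x-view   : ∀ i → GroundView (xe R i)
    y-view   : ∀ i → GroundView (ye R i)
    tip-view : GroundView (tip R)

  groundView : ∀ j → GroundView j
  groundView j with splitAt (R + R) j in eq
  ... | inj₂ zero = subst GroundView (splitAt⁻¹-↑ʳ eq) tip-view
  ... | inj₁ k with splitAt R k in eq′
  ...   | inj₁ i = subst GroundView (trans (cong (_↑ˡ 1) (splitAt⁻¹-↑ˡ eq′)) (splitAt⁻¹-↑ˡ eq)) (x-view i)
  ...   | inj₂ i = subst GroundView (trans (cong (_↑ˡ 1) (splitAt⁻¹-↑ʳ eq′)) (splitAt⁻¹-↑ˡ eq)) (y-view i)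

  xorSum-ground : (h : Fin (R + R + 1) → Bool) →
    xorSum h ≡ (xorSum (h ∘ xe R) xor xorSum (h ∘ ye R)) xor h (tip R)
  xorSum-ground h = trans (xorSum-↑ (R + R) 1 h)
    (cong₂ _xor_ (xorSum-↑ R R (h ∘ (_↑ˡ 1))) (xor-identityʳ (h (tip R))))

  ∑-ground : (h : Fin (R + R + 1) → ℕ) → sum h ≡ (sum (h ∘ xe R) + sum (h ∘ ye R)) + h (tip R)
  ∑-ground h = trans (∑-↑ (R + R) 1 h) (cong₂ _+_ (∑-↑ R R (h ∘ (_↑ˡ 1))) (+-identityʳ (h (tip R))))

  ∣∣-transversal : (T : Subset (R + R + 1)) →
    (∀ i → lookup T (xe R i) xor lookup T (ye R i) ≡ true) → ∣ T ∣ ≡ R + bit (lookup T (tip R))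
  ∣∣-transversal T one-per-leg = begin
    ∣ T ∣
      ≡⟨ trans (∣p∣≡∑ T) (∑-ground (bit ∘ lookup T)) ⟩
    sum (bit ∘ lookup T ∘ xe R) + sum (bit ∘ lookup T ∘ ye R) + bit (lookup T (tip R))
      ≡⟨ cong (_+ bit (lookup T (tip R))) (∑-distrib-+ (bit ∘ lookup T ∘ xe R) (bit ∘ lookup T ∘ ye R)) ⟨
    sum (λ i → bit (lookup T (xe R i)) + bit (lookup T (ye R i))) + bit (lookup T (tip R))
      ≡⟨ cong (_+ bit (lookup T (tip R))) (trans (sum-cong-≗ leg≡1) (∑-1 R)) ⟩
    R + bit (lookup T (tip R)) ∎
    where
    open ≡-Reasoning
    bits≡1 : ∀ a b → a xor b ≡ true → bit a + bit b ≡ 1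
    bits≡1 false true  _ = refl
    bits≡1 true  false _ = refl
    ∑-1 : ∀ n → sum {n} (λ _ → 1) ≡ n
    ∑-1 zero = refl
    ∑-1 (suc n) = cong suc (∑-1 n)
    leg≡1 : ∀ i → bit (lookup T (xe R i)) + bit (lookup T (ye R i)) ≡ 1
    leg≡1 i = bits≡1 (lookup T (xe R i)) (lookup T (ye R i)) (one-per-leg i)

  Zmat-x : ∀ i a → Zmat R i (xe R a) ≡ does (a Fin.≟ i)
  Zmat-x i a rewrite splitAt-↑ˡ (R + R) (a ↑ˡ R) 1 | splitAt-↑ˡ R a R = refl

  Zmat-y : ∀ i a → Zmat R i (ye R a) ≡ not (does (a Fin.≟ i))
  Zmat-y i a rewrite splitAt-↑ˡ (R + R) (R ↑ʳ a) 1 | splitAt-↑ʳ R R a = refl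

  Zmat-tip : ∀ i → Zmat R i (tip R) ≡ true
  Zmat-tip i rewrite splitAt-↑ʳ (R + R) 1 zero = refl

  yTipParity : Subset (R + R + 1) → Bool
  yTipParity T = xorSum (lookup T ∘ ye R) xor lookup T (tip R)

  colSum-Zmat : ∀ T i →
    colSum (Zmat R) T i ≡ (lookup T (xe R i) xor lookup T (ye R i)) xor yTipParity T
  colSum-Zmat T i = begin
    xorSum (λ j → lookup T j ∧ Zmat R i j)
      ≡⟨ xorSum-ground (λ j → lookup T j ∧ Zmat R i j) ⟩
    (xorSum (λ a → lookup T (xe R a) ∧ Zmat R i (xe R a))
      xor xorSum (λ a → lookup T (ye R a) ∧ Zmat R i (ye R a)))
      xor (lookup T (tip R) ∧ Zmat R i (tip R))
      ≡⟨ cong₂ _xor_ (cong₂ _xor_ x-part y-part) tip-part ⟩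
    (lookup T (xe R i) xor (xorSum (lookup T ∘ ye R) xor lookup T (ye R i))) xor lookup T (tip R)
      ≡⟨ regroup (lookup T (xe R i)) (xorSum (lookup T ∘ ye R)) (lookup T (ye R i)) (lookup T (tip R)) ⟩
    (lookup T (xe R i) xor lookup T (ye R i)) xor yTipParity T ∎
    where
    open ≡-Reasoning
    x-part : xorSum (λ a → lookup T (xe R a) ∧ Zmat R i (xe R a)) ≡ lookup T (xe R i)
    x-part = trans (xorSum-cong (λ a → cong (lookup T (xe R a) ∧_) (Zmat-x i a)))
                   (xorSum-δ (lookup T ∘ xe R) i)
    ∧-not : ∀ a b → a ∧ not b ≡ a xor (a ∧ b)
    ∧-not false b = refl
    ∧-not true  b = refl
    y-part : xorSum (λ a → lookup T (ye R a) ∧ Zmat R i (ye R a))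
           ≡ xorSum (lookup T ∘ ye R) xor lookup T (ye R i)
    y-part = begin
      xorSum (λ a → lookup T (ye R a) ∧ Zmat R i (ye R a))
        ≡⟨ xorSum-cong (λ a → trans (cong (lookup T (ye R a) ∧_) (Zmat-y i a))
                                    (∧-not (lookup T (ye R a)) (does (a Fin.≟ i)))) ⟩
      xorSum (λ a → lookup T (ye R a) xor (lookup T (ye R a) ∧ does (a Fin.≟ i)))
        ≡⟨ xorSum-xor (lookup T ∘ ye R) (λ a → lookup T (ye R a) ∧ does (a Fin.≟ i)) ⟩
      xorSum (lookup T ∘ ye R) xor xorSum (λ a → lookup T (ye R a) ∧ does (a Fin.≟ i))
        ≡⟨ cong (xorSum (lookup T ∘ ye R) xor_) (xorSum-δ (lookup T ∘ ye R) i) ⟩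
      xorSum (lookup T ∘ ye R) xor lookup T (ye R i) ∎
    tip-part : lookup T (tip R) ∧ Zmat R i (tip R) ≡ lookup T (tip R)
    tip-part = trans (cong (lookup T (tip R) ∧_) (Zmat-tip i)) (∧-identityʳ _)
    regroup : ∀ x s y t → (x xor (s xor y)) xor t ≡ (x xor y) xor (s xor t)
    regroup = solve 4 (λ x s y t → (x :+ (s :+ y)) :+ t := (x :+ y) :+ (s :+ t)) refl

  transversal-cycle : (T : Subset (R + R + 1)) →
    (∀ i → lookup T (xe R i) xor lookup T (ye R i) ≡ true) → yTipParity T ≡ true → Cycle (Zmat R) T
  transversal-cycle T one-per-leg odd i =
    trans (colSum-Zmat T i) (cong₂ _xor_ (one-per-leg i) odd)

  Zmat-cycle-cases : (T : Subset (R + R + 1)) → Nonempty T → Cycle (Zmat R) T →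
    (∃ λ k → xe R k ∈ T × ye R k ∈ T) ⊎ (∀ i → lookup T (xe R i) xor lookup T (ye R i) ≡ true)
  Zmat-cycle-cases T (j , j∈T) cycle with yTipParity T in parity
  ... | true  = inj₂ λ i → xor≡false⇒≡ (legSum i) true (trans (cong (legSum i xor_) (sym parity)) (row i))
    where
    legSum : Fin R → Bool
    legSum i = lookup T (xe R i) xor lookup T (ye R i)
    row : ∀ i → legSum i xor yTipParity T ≡ false
    row i = trans (sym (colSum-Zmat T i)) (cycle i)
  ... | false = inj₁ (full-leg (groundView j) ([]=⇒lookup j∈T))
    where
    same : ∀ i → lookup T (xe R i) ≡ lookup T (ye R i)
    same i = xor≡false⇒≡ _ _ (begin
      lookup T (xe R i) xor lookup T (ye R i)
        ≡⟨ xor-identityʳ _ ⟨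
      (lookup T (xe R i) xor lookup T (ye R i)) xor false
        ≡⟨ cong ((lookup T (xe R i) xor lookup T (ye R i)) xor_) parity ⟨
      (lookup T (xe R i) xor lookup T (ye R i)) xor yTipParity T
        ≡⟨ colSum-Zmat T i ⟨
      colSum (Zmat R) T i
        ≡⟨ cycle i ⟩
      false ∎)
      where open ≡-Reasoning
    leg-at : ∀ k → lookup T (ye R k) ≡ true → ∃ λ k → xe R k ∈ T × ye R k ∈ T
    leg-at k y∈T = k , lookup⇒[]= _ T (trans (same k) y∈T) , lookup⇒[]= _ T y∈T
    full-leg : ∀ {j} → GroundView j → lookup T j ≡ true → ∃ λ k → xe R k ∈ T × ye R k ∈ T
    full-leg (x-view k) x∈T = leg-at k (trans (sym (same k)) x∈T)
    full-leg (y-view k) y∈T = leg-at k y∈T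
    full-leg tip-view t∈T
      with k , y∈T ← xorSum≡true⇒∃ (lookup T ∘ ye R)
                       (xor≡false⇒≡ (xorSum (lookup T ∘ ye R)) true
                         (trans (cong (xorSum (lookup T ∘ ye R) xor_) (sym t∈T)) parity))
      = leg-at k y∈T

  xorSum-∩-Yset : (T : Subset (R + R + 1)) → xorSum (lookup (T ∩ Yset R)) ≡ xorSum (lookup T ∘ ye R)
  xorSum-∩-Yset T = begin
    xorSum (lookup (T ∩ Yset R))
      ≡⟨ xorSum-cong (lookup-∩ T (Yset R)) ⟩
    xorSum (λ j → lookup T j ∧ lookup (Yset R) j)
      ≡⟨ xorSum-ground (λ j → lookup T j ∧ lookup (Yset R) j) ⟩
    (xorSum (λ a → lookup T (xe R a) ∧ lookup (Yset R) (xe R a))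
      xor xorSum (λ a → lookup T (ye R a) ∧ lookup (Yset R) (ye R a)))
      xor (lookup T (tip R) ∧ lookup (Yset R) (tip R))
      ≡⟨ cong₂ _xor_ (cong₂ _xor_ x-part y-part) tip-part ⟩
    (false xor xorSum (lookup T ∘ ye R)) xor false
      ≡⟨ xor-identityʳ _ ⟩
    xorSum (lookup T ∘ ye R) ∎
    where
    open ≡-Reasoning
    Yset-x : ∀ a → lookup (Yset R) (xe R a) ≡ false
    Yset-x a rewrite (lookup (Yset R) (xe R a) ≡ _ ∋ lookup∘tabulate _ (xe R a))
                   | splitAt-↑ˡ (R + R) (a ↑ˡ R) 1 | splitAt-↑ˡ R a R = refl
    Yset-y : ∀ a → lookup (Yset R) (ye R a) ≡ true
    Yset-y a rewrite (lookup (Yset R) (ye R a) ≡ _ ∋ lookup∘tabulate _ (ye R a))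
                   | splitAt-↑ˡ (R + R) (R ↑ʳ a) 1 | splitAt-↑ʳ R R a = refl
    Yset-tip : lookup (Yset R) (tip R) ≡ false
    Yset-tip rewrite (lookup (Yset R) (tip R) ≡ _ ∋ lookup∘tabulate _ (tip R))
                   | splitAt-↑ʳ (R + R) 1 zero = refl
    x-part : xorSum (λ a → lookup T (xe R a) ∧ lookup (Yset R) (xe R a)) ≡ false
    x-part = trans (xorSum-cong (λ a → trans (cong (lookup T (xe R a) ∧_) (Yset-x a)) (∧-zeroʳ _)))
                   (xorSum-false {R})
    y-part : xorSum (λ a → lookup T (ye R a) ∧ lookup (Yset R) (ye R a)) ≡ xorSum (lookup T ∘ ye R)
    y-part = xorSum-cong (λ a → trans (cong (lookup T (ye R a) ∧_) (Yset-y a)) (∧-identityʳ _))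
    tip-part : lookup T (tip R) ∧ lookup (Yset R) (tip R) ≡ false
    tip-part = trans (cong (lookup T (tip R) ∧_) Yset-tip) (∧-zeroʳ _)

  onGround : (Fin R → Bool) → (Fin R → Bool) → Bool → Fin (R + R + 1) → Bool
  onGround fx fy ft j with splitAt (R + R) j
  ... | inj₂ _ = ft
  ... | inj₁ k with splitAt R k
  ...   | inj₁ i = fx i
  ...   | inj₂ i = fy i

  onGround-x : ∀ fx fy ft i → onGround fx fy ft (xe R i) ≡ fx i
  onGround-x fx fy ft i rewrite splitAt-↑ˡ (R + R) (i ↑ˡ R) 1 | splitAt-↑ˡ R i R = refl

  onGround-y : ∀ fx fy ft i → onGround fx fy ft (ye R i) ≡ fy i
  onGround-y fx fy ft i rewrite splitAt-↑ˡ (R + R) (R ↑ʳ i) 1 | splitAt-↑ʳ R R i = refl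

  onGround-tip : ∀ fx fy ft → onGround fx fy ft (tip R) ≡ ft
  onGround-tip fx fy ft rewrite splitAt-↑ʳ (R + R) 1 zero = refl

  legTriangle : Fin R → Subset (R + R + 1)
  legTriangle k = tabulate (onGround (λ i → does (i Fin.≟ k)) (λ i → does (i Fin.≟ k)) true)

  module _ (k : Fin R) where

    private
      triangle-x : ∀ i → lookup (legTriangle k) (xe R i) ≡ does (i Fin.≟ k)
      triangle-x i = trans (lookup∘tabulate _ (xe R i)) (onGround-x _ _ true i)

      triangle-y : ∀ i → lookup (legTriangle k) (ye R i) ≡ does (i Fin.≟ k)
      triangle-y i = trans (lookup∘tabulate _ (ye R i)) (onGround-y _ _ true i)

      triangle-tip : lookup (legTriangle k) (tip R) ≡ true
      triangle-tip = trans (lookup∘tabulate _ (tip R)) (onGround-tip _ _ true)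

    tip∈legTriangle : tip R ∈ legTriangle k
    tip∈legTriangle = lookup⇒[]= (tip R) (legTriangle k) triangle-tip

    legTriangle-cycle : Cycle (Zmat R) (legTriangle k)
    legTriangle-cycle i = begin
      colSum (Zmat R) (legTriangle k) i
        ≡⟨ colSum-Zmat (legTriangle k) i ⟩
      (lookup (legTriangle k) (xe R i) xor lookup (legTriangle k) (ye R i))
        xor (xorSum (lookup (legTriangle k) ∘ ye R) xor lookup (legTriangle k) (tip R))
        ≡⟨ cong₂ _xor_ (cong₂ _xor_ (triangle-x i) (triangle-y i))
                       (cong₂ _xor_ (trans (xorSum-cong triangle-y) (xorSum-δ (λ _ → true) k)) triangle-tip) ⟩
      (does (i Fin.≟ k) xor does (i Fin.≟ k)) xor (true xor true)
        ≡⟨ cong (_xor false) (xor-same (does (i Fin.≟ k))) ⟩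
      false ∎
      where open ≡-Reasoning

    legTriangle⁻ : ∀ {j} → j ∈ legTriangle k → j ≡ xe R k ⊎ j ≡ ye R k ⊎ j ≡ tip R
    legTriangle⁻ {j} j∈ = go (groundView j) ([]=⇒lookup j∈)
      where
      ≟-sound : ∀ {i} → does (i Fin.≟ k) ≡ true → i ≡ k
      ≟-sound {i} eq with i Fin.≟ k
      ... | yes i≡k = i≡k
      go : ∀ {j} → GroundView j → lookup (legTriangle k) j ≡ true → j ≡ xe R k ⊎ j ≡ ye R k ⊎ j ≡ tip R
      go (x-view i) i≡k = inj₁ (cong (xe R) (≟-sound (trans (sym (triangle-x i)) i≡k)))
      go (y-view i) i≡k = inj₂ (inj₁ (cong (ye R) (≟-sound (trans (sym (triangle-y i)) i≡k))))
      go tip-view   _   = inj₂ (inj₂ refl)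

-- Shifted unit vectors over GF(2)

three-points-do-not-cover : ∀ {r} → 3 < r → (a b c : Fin r) → ¬ (∀ i → i ≡ a ⊎ i ≡ b ⊎ i ≡ c)
three-points-do-not-cover 3<r a b c cover =
  let i , j , i<j , same-tag = pigeonhole 3<r (tag ∘ cover) in
  <-irrefl (trans (sym (point∘tag (cover i))) (trans (cong point same-tag) (point∘tag (cover j)))) i<j
  where
  point : Fin 3 → Fin _
  point zero             = a
  point (suc zero)       = b
  point (suc (suc zero)) = c
  tag : ∀ {i} → i ≡ a ⊎ i ≡ b ⊎ i ≡ c → Fin 3
  tag (inj₁ _)        = zero
  tag (inj₂ (inj₁ _)) = suc zero
  tag (inj₂ (inj₂ _)) = suc (suc zero)
  point∘tag : ∀ {i} (p : i ≡ a ⊎ i ≡ b ⊎ i ≡ c) → point (tag p) ≡ i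
  point∘tag (inj₁ i≡a)        = sym i≡a
  point∘tag (inj₂ (inj₁ i≡b)) = sym i≡b
  point∘tag (inj₂ (inj₂ i≡c)) = sym i≡c

unitVec : ∀ {r} → Maybe (Fin r) → Fin r → Bool
unitVec nothing  i = false
unitVec (just a) i = does (a Fin.≟ i)

shiftedUnit : ∀ {r} → Bool → Maybe (Fin r) → Fin r → Bool
shiftedUnit c m i = c xor unitVec m i

private
  unitVec-on : ∀ {r} (a : Fin r) → unitVec (just a) a ≡ true
  unitVec-on a = dec-true (a Fin.≟ a) refl

  unitVec-off : ∀ {r} {a i : Fin r} → a ≢ i → unitVec (just a) i ≡ false
  unitVec-off {a = a} {i} a≢i = dec-false (a Fin.≟ i) a≢i

  module ShiftedUnitRelation {r} (3<r : 3 < r) {a b : Fin r} (a≢b : a ≢ b) (cu cv cw : Bool)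
    (mw : Maybe (Fin r)) (tu tv tw : Bool)
    (vanishes : ∀ i → (tu ∧ shiftedUnit cu (just a) i)
                        xor ((tv ∧ shiftedUnit cv (just b) i) xor (tw ∧ shiftedUnit cw mw i)) ≡ false)
    where

    K : Bool
    K = (tu ∧ cu) xor ((tv ∧ cv) xor (tw ∧ cw))

    L : Fin r → Bool
    L i = (tu ∧ unitVec (just a) i) xor ((tv ∧ unitVec (just b) i) xor (tw ∧ unitVec mw i))

    K⊕L : ∀ i → K xor L i ≡ false
    K⊕L i = trans (sym (distribute tu tv tw cu cv cw _ _ _)) (vanishes i)
      where
      distribute : ∀ tu tv tw cu cv cw x y z →
        (tu ∧ (cu xor x)) xor ((tv ∧ (cv xor y)) xor (tw ∧ (cw xor z)))
        ≡ ((tu ∧ cu) xor ((tv ∧ cv) xor (tw ∧ cw))) xor ((tu ∧ x) xor ((tv ∧ y) xor (tw ∧ z)))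
      distribute = solve 9 (λ tu tv tw cu cv cw x y z →
        (tu :* (cu :+ x)) :+ ((tv :* (cv :+ y)) :+ (tw :* (cw :+ z))) :=
        ((tu :* cu) :+ ((tv :* cv) :+ (tw :* cw))) :+ ((tu :* x) :+ ((tv :* y) :+ (tw :* z)))) refl

    -- K is the value of the combination at any row avoiding a, b and mw;
    -- such a row exists because r ≥ 4.
    K≡false : K ≡ false
    K≡false with K in K≡
    ... | false = refl
    ... | true  = contradiction cover (three-points-do-not-cover 3<r a b (fromMaybe a mw))
      where
      L≡true : ∀ i → L i ≡ true
      L≡true i = sym (xor≡false⇒≡ true (L i) (trans (cong (_xor L i) (sym K≡)) (K⊕L i)))
      L-off : ∀ {i} → a ≢ i → b ≢ i → unitVec mw i ≡ false → L i ≡ false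
      L-off a≢i b≢i w-off rewrite unitVec-off a≢i | unitVec-off b≢i | w-off
                                | ∧-zeroʳ tu | ∧-zeroʳ tv | ∧-zeroʳ tw = refl
      off-unit : ∀ m {i} → i ≢ fromMaybe a m → unitVec m i ≡ false
      off-unit nothing  _   = refl
      off-unit (just c) i≢c = unitVec-off (i≢c ∘ sym)
      cover : ∀ i → i ≡ a ⊎ i ≡ b ⊎ i ≡ fromMaybe a mw
      cover i with i Fin.≟ a | i Fin.≟ b | i Fin.≟ fromMaybe a mw
      ... | yes i≡a | _       | _       = inj₁ i≡a
      ... | no _    | yes i≡b | _       = inj₂ (inj₁ i≡b)
      ... | no _    | no _    | yes i≡c = inj₂ (inj₂ i≡c)
      ... | no i≢a  | no i≢b  | no i≢c  =
        case trans (sym (L≡true i)) (L-off (i≢a ∘ sym) (i≢b ∘ sym) (off-unit mw i≢c)) of λ ()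

    L≡false : ∀ i → L i ≡ false
    L≡false i = trans (cong (_xor L i) (sym K≡false)) (K⊕L i)

    u-coeff : tu ≡ tw ∧ unitVec mw a
    u-coeff = xor≡false⇒≡ tu (tw ∧ unitVec mw a) (trans (sym row-a) (L≡false a))
      where
      row-a : L a ≡ tu xor (tw ∧ unitVec mw a)
      row-a rewrite unitVec-on a | unitVec-off (a≢b ∘ sym) | ∧-identityʳ tu | ∧-zeroʳ tv = refl

    v-coeff : tv ≡ tw ∧ unitVec mw b
    v-coeff = xor≡false⇒≡ tv (tw ∧ unitVec mw b) (trans (sym row-b) (L≡false b))
      where
      row-b : L b ≡ tv xor (tw ∧ unitVec mw b)
      row-b rewrite unitVec-on b | unitVec-off a≢b | ∧-identityʳ tv | ∧-zeroʳ tu = refl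

shiftedUnit-relation : ∀ {r} → 3 < r → {a b : Fin r} → a ≢ b →
  ∀ {cu cv cw} (mw : Maybe (Fin r)) → (mw ≡ just a → cw ≢ cu) → (mw ≡ just b → cw ≢ cv) →
  ∀ {tu tv tw} →
  (∀ i → (tu ∧ shiftedUnit cu (just a) i)
           xor ((tv ∧ shiftedUnit cv (just b) i) xor (tw ∧ shiftedUnit cw mw i)) ≡ false) →
  tu ≡ false × tv ≡ false × (tw ≡ true → mw ≡ nothing × cw ≡ false)
shiftedUnit-relation 3<r a≢b {cu} {cv} {cw} nothing _ _ {tu} {tv} {tw} vanishes =
  tu≡false , tv≡false , λ tw≡true → refl , trans (cong (_∧ cw) (sym tw≡true)) tw∧cw≡false
  where
  open ShiftedUnitRelation 3<r a≢b cu cv cw nothing tu tv tw vanishes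
  tu≡false : tu ≡ false
  tu≡false = trans u-coeff (∧-zeroʳ tw)
  tv≡false : tv ≡ false
  tv≡false = trans v-coeff (∧-zeroʳ tw)
  tw∧cw≡false : tw ∧ cw ≡ false
  tw∧cw≡false = subst₂ (λ x y → (x ∧ cu) xor ((y ∧ cv) xor (tw ∧ cw)) ≡ false) tu≡false tv≡false K≡false
shiftedUnit-relation 3<r {a} {b} a≢b {cu} {cv} {cw} (just c) w≢u w≢v {tu} {tv} {tw} vanishes
  with c Fin.≟ a | c Fin.≟ b
... | yes refl | _ = trans tu≡tw tw≡false , tv≡false , λ tw≡true → case trans (sym tw≡true) tw≡false of λ ()
  where
  open ShiftedUnitRelation 3<r a≢b cu cv cw (just a) tu tv tw vanishes
  tu≡tw : tu ≡ tw
  tu≡tw = trans u-coeff (trans (cong (tw ∧_) (unitVec-on a)) (∧-identityʳ tw))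
  tv≡false : tv ≡ false
  tv≡false = trans v-coeff (trans (cong (tw ∧_) (unitVec-off a≢b)) (∧-zeroʳ tw))
  tw≡false : tw ≡ false
  tw≡false = ∧-cancelˡ tw (w≢u refl ∘ sym) (xor≡false⇒≡ (tw ∧ cu) (tw ∧ cw)
    (subst₂ (λ x y → (x ∧ cu) xor ((y ∧ cv) xor (tw ∧ cw)) ≡ false) tu≡tw tv≡false K≡false))
... | no _ | yes refl =
  tu≡false , trans tv≡tw tw≡false , λ tw≡true → case trans (sym tw≡true) tw≡false of λ ()
  where
  open ShiftedUnitRelation 3<r a≢b cu cv cw (just b) tu tv tw vanishes
  tv≡tw : tv ≡ tw
  tv≡tw = trans v-coeff (trans (cong (tw ∧_) (unitVec-on b)) (∧-identityʳ tw))
  tu≡false : tu ≡ false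
  tu≡false = trans u-coeff (trans (cong (tw ∧_) (unitVec-off (a≢b ∘ sym))) (∧-zeroʳ tw))
  tw≡false : tw ≡ false
  tw≡false = ∧-cancelˡ tw (w≢v refl ∘ sym) (xor≡false⇒≡ (tw ∧ cv) (tw ∧ cw)
    (subst₂ (λ x y → (x ∧ cu) xor ((y ∧ cv) xor (tw ∧ cw)) ≡ false) tu≡false tv≡tw K≡false))
... | no c≢a | no c≢b = trans u-coeff (cong (_∧ _) tw≡false) , trans v-coeff (cong (_∧ _) tw≡false)
                      , λ tw≡true → case trans (sym tw≡true) tw≡false of λ ()
  where
  open ShiftedUnitRelation 3<r a≢b cu cv cw (just c) tu tv tw vanishes
  row-c : L c ≡ tw
  row-c rewrite unitVec-off (c≢a ∘ sym) | unitVec-off (c≢b ∘ sym) | unitVec-on c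
              | ∧-zeroʳ tu | ∧-zeroʳ tv | ∧-identityʳ tw = refl
  tw≡false : tw ≡ false
  tw≡false = trans (sym row-c) (L≡false c)

-- es-splitting

module _ {m n} (M : Mat m n) (X : Subset n) (e : Fin n) where

  split-↑ˡ : ∀ k j → split M X e k (j ↑ˡ 2) ≡ extCol M X j k
  split-↑ˡ k j rewrite splitAt-↑ˡ n j 2 = refl

  extCol-top : ∀ i j → extCol M X j (i ↑ˡ 1) ≡ M i j
  extCol-top i j rewrite splitAt-↑ˡ m i 1 = refl

  extCol-bottom : ∀ j → extCol M X j (m ↑ʳ zero) ≡ lookup X j
  extCol-bottom j rewrite splitAt-↑ʳ m 1 zero = refl

  split-α-top : ∀ i → split M X e (i ↑ˡ 1) (n ↑ʳ zero) ≡ false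
  split-α-top i rewrite splitAt-↑ʳ n 2 zero | splitAt-↑ˡ m i 1 = refl

  split-α-bottom : split M X e (m ↑ʳ zero) (n ↑ʳ zero) ≡ true
  split-α-bottom rewrite splitAt-↑ʳ n 2 zero | splitAt-↑ʳ m 1 zero = refl

  split-γ-top : ∀ i → split M X e (i ↑ˡ 1) (n ↑ʳ suc zero) ≡ M i e
  split-γ-top i rewrite splitAt-↑ʳ n 2 (suc zero) | splitAt-↑ˡ m i 1 = refl

  colSum-split-lift : (S : Subset n) (k : Fin (m + 1)) →
    colSum (split M X e) (S ++ ⊥) k ≡ xorSum (λ j → lookup S j ∧ extCol M X j k)
  colSum-split-lift S k = begin
    xorSum (λ j → lookup (S ++ ⊥) j ∧ split M X e k j)
      ≡⟨ xorSum-↑ n 2 (λ j → lookup (S ++ ⊥) j ∧ split M X e k j) ⟩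
    xorSum (λ j → lookup (S ++ ⊥) (j ↑ˡ 2) ∧ split M X e k (j ↑ˡ 2))
      xor xorSum (λ l → lookup (S ++ ⊥) (n ↑ʳ l) ∧ split M X e k (n ↑ʳ l))
      ≡⟨ cong₂ _xor_ (xorSum-cong original) (trans (xorSum-cong new) (xorSum-false {2})) ⟩
    xorSum (λ j → lookup S j ∧ extCol M X j k) xor false
      ≡⟨ xor-identityʳ _ ⟩
    xorSum (λ j → lookup S j ∧ extCol M X j k) ∎
    where
    open ≡-Reasoning
    original : ∀ j → lookup (S ++ ⊥) (j ↑ˡ 2) ∧ split M X e k (j ↑ˡ 2) ≡ lookup S j ∧ extCol M X j k
    original j = cong₂ _∧_ (lookup-++ˡ S ⊥ j) (split-↑ˡ k j)
    new : ∀ l → lookup (S ++ ⊥) (n ↑ʳ l) ∧ split M X e k (n ↑ʳ l) ≡ false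
    new l = cong (_∧ split M X e k (n ↑ʳ l)) (trans (lookup-++ʳ S ⊥ l) (lookup-replicate l outside))

  split-lift-cycle : (S : Subset n) → Cycle M S → xorSum (lookup (S ∩ X)) ≡ false →
    Cycle (split M X e) (S ++ ⊥)
  split-lift-cycle S S-cycle S∩X-even k with splitAt m k in eq
  ... | inj₁ i rewrite sym (splitAt⁻¹-↑ˡ eq) = begin
    colSum (split M X e) (S ++ ⊥) (i ↑ˡ 1)
      ≡⟨ colSum-split-lift S (i ↑ˡ 1) ⟩
    xorSum (λ j → lookup S j ∧ extCol M X j (i ↑ˡ 1))
      ≡⟨ xorSum-cong (λ j → cong (lookup S j ∧_) (extCol-top i j)) ⟩
    colSum M S i
      ≡⟨ S-cycle i ⟩
    false ∎
    where open ≡-Reasoning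
  ... | inj₂ zero rewrite sym (splitAt⁻¹-↑ʳ eq) = begin
    colSum (split M X e) (S ++ ⊥) (m ↑ʳ zero)
      ≡⟨ colSum-split-lift S (m ↑ʳ zero) ⟩
    xorSum (λ j → lookup S j ∧ extCol M X j (m ↑ʳ zero))
      ≡⟨ xorSum-cong (λ j → cong (lookup S j ∧_) (extCol-bottom j)) ⟩
    xorSum (λ j → lookup S j ∧ lookup X j)
      ≡⟨ xorSum-cong (lookup-∩ S X) ⟨
    xorSum (lookup (S ∩ X))
      ≡⟨ S∩X-even ⟩
    false ∎
    where open ≡-Reasoning

leg : ∀ r → Fin r → Bool → Fin (r + r + 1)
leg r a false = xe r a
leg r a true  = ye r a

Zmat-leg : ∀ r i a c → Zmat r i (leg r a c) ≡ shiftedUnit c (just a) i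
Zmat-leg r i a false = Zmat-x r i a
Zmat-leg r i a true  = Zmat-y r i a

leg-index-injective : ∀ {r a b c c′} → leg r a c ≡ leg r b c′ → a ≡ b
leg-index-injective {r} {c = false} {false} eq = xe-injective r eq
leg-index-injective {r} {c = true}  {true}  eq = ye-injective r eq
leg-index-injective {r} {a} {b} {false} {true}  eq = contradiction eq (xe≢ye r a b)
leg-index-injective {r} {a} {b} {true}  {false} eq = contradiction (sym eq) (xe≢ye r b a)

module Splitting (r : ℕ) (X : Subset (r + r + 1)) where

  A : Mat (r + 1) (r + r + 1 + 2)
  A = split (Zmat r) X (tip r)

  bottom : Fin (r + 1)
  bottom = r ↑ʳ zero

  record TopForm (j : Fin (r + r + 1 + 2)) : Set where
    field
      shift       : Bool
      unit        : Maybe (Fin r)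
      top         : ∀ i → A (i ↑ˡ 1) j ≡ shiftedUnit shift unit i
      unit⇒leg    : ∀ {a} → unit ≡ just a → j ≡ leg r a shift ↑ˡ 2
      zero⇒bottom : unit ≡ nothing → shift ≡ false → A bottom j ≡ true

  legForm : ∀ a c → TopForm (leg r a c ↑ˡ 2)
  legForm a c = record
    { shift = c ; unit = just a
    ; top = λ i → trans (split-↑ˡ (Zmat r) X (tip r) (i ↑ˡ 1) (leg r a c))
                        (trans (extCol-top (Zmat r) X (tip r) i (leg r a c)) (Zmat-leg r i a c))
    ; unit⇒leg = λ { refl → refl }
    ; zero⇒bottom = λ ()
    }

  topForm : ∀ j → TopForm j
  topForm j with splitAt (r + r + 1) j in eq
  ... | inj₁ j′ = subst TopForm (splitAt⁻¹-↑ˡ eq) (ground-form (groundView r j′))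
    where
    ground-form : ∀ {j′} → GroundView r j′ → TopForm (j′ ↑ˡ 2)
    ground-form (x-view a) = legForm a false
    ground-form (y-view a) = legForm a true
    ground-form tip-view = record
      { shift = true ; unit = nothing
      ; top = λ i → trans (split-↑ˡ (Zmat r) X (tip r) (i ↑ˡ 1) (tip r))
                          (trans (extCol-top (Zmat r) X (tip r) i (tip r)) (Zmat-tip r i))
      ; unit⇒leg = λ ()
      ; zero⇒bottom = λ _ ()
      }
  ... | inj₂ zero = subst TopForm (splitAt⁻¹-↑ʳ eq) record
    { shift = false ; unit = nothing
    ; top = split-α-top (Zmat r) X (tip r)
    ; unit⇒leg = λ ()
    ; zero⇒bottom = λ _ _ → split-α-bottom (Zmat r) X (tip r)
    }
  ... | inj₂ (suc zero) = subst TopForm (splitAt⁻¹-↑ʳ eq) record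
    { shift = true ; unit = nothing
    ; top = λ i → trans (split-γ-top (Zmat r) X (tip r) i) (Zmat-tip r i)
    ; unit⇒leg = λ ()
    ; zero⇒bottom = λ _ ()
    }

  module _ (3<r : 3 < r) {a b cu cv} (a≢b : a ≢ b) (w : Fin (r + r + 1 + 2))
    (w≢u : w ≢ leg r a cu ↑ˡ 2) (w≢v : w ≢ leg r b cv ↑ˡ 2) where

    private
      u v : Fin (r + r + 1 + 2)
      u = leg r a cu ↑ˡ 2
      v = leg r b cv ↑ˡ 2

    Cycle-⊆-two-legs+1⇒empty : (T : Subset (r + r + 1 + 2)) →
      (∀ j → lookup T j ≡ true → j ≡ u ⊎ j ≡ v ⊎ j ≡ w) → Cycle A T → ∀ j → lookup T j ≡ false
    Cycle-⊆-two-legs+1⇒empty T support T-cycle j =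
      ¬-not λ Tj → case trans (sym (off-uvw (support j Tj))) Tj of λ ()
      where
      open TopForm (topForm w)
      u≢v : u ≢ v
      u≢v = a≢b ∘ leg-index-injective {c = cu} {cv} ∘ ↑ˡ-injective 2 _ _
      combination : Bool → Bool → Bool → Bool
      combination x y z = (lookup T u ∧ x) xor ((lookup T v ∧ y) xor (lookup T w ∧ z))
      row : ∀ k → combination (A k u) (A k v) (A k w) ≡ false
      row k = trans (sym (xorSum-support₃ u≢v (w≢u ∘ sym) (w≢v ∘ sym) (lookup T) (A k) support)) (T-cycle k)
      top-rows : ∀ i → combination (shiftedUnit cu (just a) i) (shiftedUnit cv (just b) i)
                                   (shiftedUnit shift unit i) ≡ false
      top-rows i = trans (sym (trans (cong₂ (λ x y → combination x y (A (i ↑ˡ 1) w))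
                                            (TopForm.top (legForm a cu) i) (TopForm.top (legForm b cv) i))
                                     (cong (combination _ _) (top i))))
                         (row (i ↑ˡ 1))
      w≢u-form : unit ≡ just a → shift ≢ cu
      w≢u-form unit≡a refl = w≢u (unit⇒leg unit≡a)
      w≢v-form : unit ≡ just b → shift ≢ cv
      w≢v-form unit≡b refl = w≢v (unit⇒leg unit≡b)
      coefficients : lookup T u ≡ false × lookup T v ≡ false
                     × (lookup T w ≡ true → unit ≡ nothing × shift ≡ false)
      coefficients = shiftedUnit-relation 3<r a≢b unit w≢u-form w≢v-form
                       {tu = lookup T u} {lookup T v} {lookup T w} top-rows
      Tw≡false : lookup T w ≡ false
      Tw≡false with lookup T w in Tw
      ... | false = refl
      ... | true with unit≡nothing , shift≡false ← proj₂ (proj₂ coefficients) Tw =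
        case trans (sym bottom-row) (row bottom) of λ ()
        where
        bottom-row : combination (A bottom u) (A bottom v) (A bottom w) ≡ true
        bottom-row rewrite proj₁ coefficients | proj₁ (proj₂ coefficients) | Tw
                         | zero⇒bottom unit≡nothing shift≡false = refl
      off-uvw : ∀ {j} → j ≡ u ⊎ j ≡ v ⊎ j ≡ w → lookup T j ≡ false
      off-uvw (inj₁ refl)        = proj₁ coefficients
      off-uvw (inj₂ (inj₁ refl)) = proj₁ (proj₂ coefficients)
      off-uvw (inj₂ (inj₂ refl)) = Tw≡false

    Indep-⊆-two-legs+1 : (S : Subset (r + r + 1 + 2)) →
      (∀ {j} → j ∈ S → j ≡ u ⊎ j ≡ v ⊎ j ≡ w) → Indep A S
    Indep-⊆-two-legs+1 S S⊆uvw T T⊆S (j , j∈T) T-cycle =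
      case trans (sym ([]=⇒lookup j∈T)) (Cycle-⊆-two-legs+1⇒empty T support T-cycle j) of λ ()
      where
      support : ∀ j → lookup T j ≡ true → j ≡ u ⊎ j ≡ v ⊎ j ≡ w
      support j Tj = S⊆uvw (T⊆S (lookup⇒[]= j T Tj))

-- Isomorphisms of vector matroids

module IsoTransport {m n m′ n′} {A : Mat m n} {B : Mat m′ n′} (iso : Iso A B) where

  π : Permutation n n′
  π = ⤖⇒↔ (mk⤖ (proj₁ (proj₂ iso)))

  preimage : Subset n′ → Subset n
  preimage I = tabulate (lookup I ∘ (π ⟨$⟩ʳ_))

  Indep-preimage⇔ : ∀ I → Indep A (preimage I) ⇔ Indep B I
  Indep-preimage⇔ = proj₂ (proj₂ iso)

  image : Subset n → Subset n′
  image S = tabulate (lookup S ∘ (π ⟨$⟩ˡ_))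

  ∣image∣ : (S : Subset n) → ∣ image S ∣ ≡ ∣ S ∣
  ∣image∣ = ∣∣-permute (flip π)

  ∈image⁻ : ∀ {S j} → j ∈ image S → π ⟨$⟩ˡ j ∈ S
  ∈image⁻ {S} {j} j∈ = lookup⇒[]= _ S (trans (sym (lookup∘tabulate _ j)) ([]=⇒lookup j∈))

  ∈preimage⁻ : ∀ {I j} → j ∈ preimage I → π ⟨$⟩ʳ j ∈ I
  ∈preimage⁻ {I} {j} j∈ = lookup⇒[]= _ I (trans (sym (lookup∘tabulate _ j)) ([]=⇒lookup j∈))

  Indep-image⇒Indep : ∀ S → Indep B (image S) → Indep A S
  Indep-image⇒Indep S indep T T⊆S =
    Equivalence.from (Indep-preimage⇔ (image S)) indep T (S⊆preimage∘image ∘ T⊆S)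
    where
    S⊆preimage∘image : ∀ {j} → j ∈ S → j ∈ preimage (image S)
    S⊆preimage∘image {j} j∈S = lookup⇒[]= j (preimage (image S)) (begin
      lookup (preimage (image S)) j     ≡⟨ lookup∘tabulate _ j ⟩
      lookup (image S) (π ⟨$⟩ʳ j)       ≡⟨ lookup∘tabulate _ (π ⟨$⟩ʳ j) ⟩
      lookup S (π ⟨$⟩ˡ (π ⟨$⟩ʳ j))      ≡⟨ cong (lookup S) (inverseˡ π) ⟩
      lookup S j                        ≡⟨ []=⇒lookup j∈S ⟩
      true                              ∎)
      where open ≡-Reasoning

module NoIsomorphism (r : ℕ) (3<r : 3 < r) (X C : Subset (r + r + 1))
  (C-legs : ∀ i → lookup C (xe r i) xor lookup C (ye r i) ≡ true)
  (C-tip : lookup C (tip r) ≡ false)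
  (C-odd : xorSum (lookup C ∘ ye r) ≡ true)
  (C∩X-even : xorSum (lookup (C ∩ X)) ≡ false)
  where

  open Splitting r X

  i₀ : Fin r
  i₀ = Fin.fromℕ< 3<r

  Ĉ : Subset (r + r + 1 + 2)
  Ĉ = C ++ ⊥

  Ĉ-cycle : Cycle A Ĉ
  Ĉ-cycle = split-lift-cycle (Zmat r) X (tip r) C
    (transversal-cycle r C C-legs (cong₂ _xor_ C-odd C-tip)) C∩X-even

  ∣Ĉ∣≡r : ∣ Ĉ ∣ ≡ r
  ∣Ĉ∣≡r = begin
    ∣ Ĉ ∣                        ≡⟨ ∣p++⊥∣≡∣p∣ 2 C ⟩
    ∣ C ∣                        ≡⟨ ∣∣-transversal r C C-legs ⟩
    r + bit (lookup C (tip r))   ≡⟨ cong (λ b → r + bit b) C-tip ⟩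
    r + 0                        ≡⟨ +-identityʳ r ⟩
    r                            ∎
    where open ≡-Reasoning

  Ĉ-nonempty : Nonempty Ĉ
  Ĉ-nonempty with lookup C (xe r i₀) in x∈C
  ... | true  = xe r i₀ ↑ˡ 2 , lookup⇒[]= _ Ĉ (trans (lookup-++ˡ C ⊥ (xe r i₀)) x∈C)
  ... | false = ye r i₀ ↑ˡ 2 , lookup⇒[]= _ Ĉ (trans (lookup-++ˡ C ⊥ (ye r i₀))
                  (trans (cong (_xor lookup C (ye r i₀)) (sym x∈C)) (C-legs i₀)))

  ∈Ĉ⇒∈C : ∀ {j} → j ↑ˡ 2 ∈ Ĉ → lookup C j ≡ true
  ∈Ĉ⇒∈C {j} j∈Ĉ = trans (sym (lookup-++ˡ C ⊥ j)) ([]=⇒lookup j∈Ĉ)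

  Ĉ-leg : ∀ {j} → j ∈ Ĉ → ∃ λ a → ∃ λ c → j ≡ leg r a c ↑ˡ 2
  Ĉ-leg {j} j∈Ĉ with splitAt (r + r + 1) j in eq
  ... | inj₁ j′ = on-ground (groundView r j′) (sym (splitAt⁻¹-↑ˡ eq))
    where
    on-ground : ∀ {j′} → GroundView r j′ → j ≡ j′ ↑ˡ 2 → ∃ λ a → ∃ λ c → j ≡ leg r a c ↑ˡ 2
    on-ground (x-view a) j≡x = a , false , j≡x
    on-ground (y-view a) j≡y = a , true , j≡y
    on-ground tip-view   j≡t = case trans (sym C-tip) (∈Ĉ⇒∈C (subst (_∈ Ĉ) j≡t j∈Ĉ)) of λ ()
  ... | inj₂ l = case trans (sym (trans (lookup-++ʳ C ⊥ l) (lookup-replicate l outside)))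
                   ([]=⇒lookup (subst (_∈ Ĉ) (sym (splitAt⁻¹-↑ʳ eq)) j∈Ĉ)) of λ ()

  Ĉ-one-per-leg : ∀ {a c c′} → leg r a c ↑ˡ 2 ∈ Ĉ → leg r a c′ ↑ˡ 2 ∈ Ĉ → c ≡ c′
  Ĉ-one-per-leg {a} {false} {false} _ _ = refl
  Ĉ-one-per-leg {a} {true}  {true}  _ _ = refl
  Ĉ-one-per-leg {a} {false} {true}  x∈Ĉ y∈Ĉ =
    case trans (sym (C-legs a)) (cong₂ _xor_ (∈Ĉ⇒∈C x∈Ĉ) (∈Ĉ⇒∈C y∈Ĉ)) of λ ()
  Ĉ-one-per-leg {a} {true}  {false} y∈Ĉ x∈Ĉ =
    case trans (sym (C-legs a)) (cong₂ _xor_ (∈Ĉ⇒∈C x∈Ĉ) (∈Ĉ⇒∈C y∈Ĉ)) of λ ()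

  module _ (iso : Iso A (Zmat (suc r))) where

    private
      R : ℕ
      R = suc r
      open IsoTransport {A = A} {B = Zmat R} iso

      g : Fin (R + R + 1) → Fin (r + r + 1 + 2)
      g = π ⟨$⟩ˡ_

      g-injective : ∀ {x y} → g x ≡ g y → x ≡ y
      g-injective eq = trans (sym (inverseʳ π)) (trans (cong (π ⟨$⟩ʳ_) eq) (inverseʳ π))

    image-Ĉ-has-no-full-leg : ∀ k → π ⟨$⟩ˡ xe R k ∈ Ĉ → ¬ (π ⟨$⟩ˡ ye R k ∈ Ĉ)
    image-Ĉ-has-no-full-leg k u∈Ĉ v∈Ĉ with Ĉ-leg u∈Ĉ | Ĉ-leg v∈Ĉ
    ... | a , cu , u≡ | b , cv , v≡ =
      Equivalence.to (Indep-preimage⇔ (legTriangle R k)) P-indep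
        (legTriangle R k) (λ j∈ → j∈) (tip R , tip∈legTriangle R k) (legTriangle-cycle R k)
      where
      a≢b : a ≢ b
      a≢b refl = xe≢ye R k k (g-injective (trans u≡ (trans (cong (λ c → leg r a c ↑ˡ 2) same-side) (sym v≡))))
        where
        same-side : cu ≡ cv
        same-side = Ĉ-one-per-leg {a} {cu} {cv} (subst (_∈ Ĉ) u≡ u∈Ĉ) (subst (_∈ Ĉ) v≡ v∈Ĉ)
      w≢u : g (tip R) ≢ leg r a cu ↑ˡ 2
      w≢u eq = xe≢tip R k (g-injective (trans u≡ (sym eq)))
      w≢v : g (tip R) ≢ leg r b cv ↑ˡ 2
      w≢v eq = ye≢tip R k (g-injective (trans v≡ (sym eq)))
      P⊆uvw : ∀ {j} → j ∈ preimage (legTriangle R k) →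
        j ≡ leg r a cu ↑ˡ 2 ⊎ j ≡ leg r b cv ↑ˡ 2 ⊎ j ≡ g (tip R)
      P⊆uvw {j} j∈P with legTriangle⁻ R k (∈preimage⁻ j∈P)
      ... | inj₁ πj≡x        = inj₁ (trans (sym (inverseˡ π)) (trans (cong g πj≡x) u≡))
      ... | inj₂ (inj₁ πj≡y) = inj₂ (inj₁ (trans (sym (inverseˡ π)) (trans (cong g πj≡y) v≡)))
      ... | inj₂ (inj₂ πj≡t) = inj₂ (inj₂ (trans (sym (inverseˡ π)) (cong g πj≡t)))
      P-indep : Indep A (preimage (legTriangle R k))
      P-indep = Indep-⊆-two-legs+1 3<r {a} {b} {cu} {cv} a≢b (g (tip R)) w≢u w≢v
                  (preimage (legTriangle R k)) P⊆uvw

    Indep-image-Ĉ : Indep (Zmat R) (image Ĉ)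
    Indep-image-Ĉ T T⊆D T≢∅ T-cycle with Zmat-cycle-cases R T T≢∅ T-cycle
    ... | inj₁ (k , x∈T , y∈T) = image-Ĉ-has-no-full-leg k (∈image⁻ (T⊆D x∈T)) (∈image⁻ (T⊆D y∈T))
    ... | inj₂ one-per-leg = ℕ.n≮n r (begin-strict
      r                           <⟨ ℕ.m≤m+n R _ ⟩
      R + bit (lookup T (tip R))  ≡⟨ ∣∣-transversal R T one-per-leg ⟨
      ∣ T ∣                       ≤⟨ p⊆q⇒∣p∣≤∣q∣ T⊆D ⟩
      ∣ image Ĉ ∣                 ≡⟨ ∣image∣ Ĉ ⟩
      ∣ Ĉ ∣                       ≡⟨ ∣Ĉ∣≡r ⟩
      r                           ∎)
      where open ℕ.≤-Reasoning

  ¬Iso : ¬ Iso A (Zmat (suc r))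
  ¬Iso iso = Indep-image⇒Indep Ĉ (Indep-image-Ĉ iso) Ĉ (λ j∈Ĉ → j∈Ĉ) Ĉ-nonempty Ĉ-cycle
    where open IsoTransport {A = A} {B = Zmat (suc r)} iso

lemma8 : (r : ℕ) → 4 ≤ r → (X : Subset (r + r + 1)) → tip r ∈ X →
    (C : Subset (r + r + 1)) → ∣ C ∣ ≡ r →
    (∀ i → ∣ C ∩ pairXY r i ∣ ≡ 1) →
    ∣ C ∩ Yset r ∣ % 2 ≡ 1 →
    ∣ C ∩ X ∣ % 2 ≡ 0 →
    ¬ Iso (split (Zmat r) X (tip r)) (Zmat (suc r))
lemma8 r 4≤r X _ C ∣C∣≡r pairs oddY evenX =
  NoIsomorphism.¬Iso r 4≤r X C C-legs C-tip C-odd (xorSum-parity (C ∩ X) false evenX)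
  where
  C-legs : ∀ i → lookup C (xe r i) xor lookup C (ye r i) ≡ true
  C-legs i = trans (sym (xorSum-∩-pair (xe≢ye r i i) C))
                   (xorSum-parity (C ∩ pairXY r i) true (cong (_% 2) (pairs i)))
  C-tip : lookup C (tip r) ≡ false
  C-tip = bit-injective (ℕ.+-cancelˡ-≡ r _ 0 (begin
    r + bit (lookup C (tip r))  ≡⟨ ∣∣-transversal r C C-legs ⟨
    ∣ C ∣                       ≡⟨ ∣C∣≡r ⟩
    r                           ≡⟨ +-identityʳ r ⟨
    r + 0                       ∎))
    where open ≡-Reasoning
  C-odd : xorSum (lookup C ∘ ye r) ≡ true
  C-odd = trans (sym (xorSum-∩-Yset r C)) (xorSum-parity (C ∩ Yset r) true oddY)
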